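{- A $2$-edge-coloured graph $G=(\Gamma,R,B)$ is chromatically invariant if and only if $G$ has no induced bichromatic $2$-path and $G$ contains no induced bichromatic copy of $2K_2$.
   Context: All graphs are finite and simple. A $2$-edge-coloured graph is a triple $G=(\Gamma,R,B)$ with $R,B\subseteq E(\Gamma)$, $R\cap B=\emptyset$, $R\cup B=E(\Gamma)$ (red and blue edges). A $k$-colouring of $G$ is a proper vertex colouring $c:V(\Gamma)\to\{1,\dots,k\}$ of $\Gamma$ such that for every $ux\in R$ and $vy\in B$ (either endpoint may play the role of $u$, resp. $v$), $c(u)=c(v)$ implies $c(x)\ne c(y)$. $P(G,\lambda)$ is the polynomial whose value at each non-negative integer $k$ is the number of $k$-colourings of $G$. $G$ is chromatically invariant if $P(G,\lambda)=P(\Gamma,\lambda)$, the usual chromatic polynomial of $\Gamma$. An induced bichromatic $2$-path is an induced path $xuy$ of $\Gamma$ (so $xy\notin E(\Gamma)$) with $xu\in R$ and $uy\in B$. An induced bichromatic copy of $2K_2$ consists of four distinct vertices $u,x,v,y$ with $ux\in R$, $vy\in B$ and no other edges of $\Gamma$ among $\{u,x,v,y\}$. -}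

module Defs where

open import Data.Nat using (ℕ; zero; suc)
open import Data.Fin using (Fin)
open import Data.Fin.Properties using (all?) renaming (_≟_ to _≟F_)
open import Data.Bool using (Bool; true; false)
open import Data.Bool.Properties renaming (_≟_ to _≟B_)
open import Data.Vec using (Vec; []; _∷_; lookup)
open import Data.List using (List; [_]; map; concatMap; length; filter; allFin)
open import Data.Product using (_×_; ∃-syntax)
open import Relation.Binary.PropositionalEquality using (_≡_; _≢_)
open import Relation.Nullary using (¬_; Dec)
open import Relation.Nullary.Decidable using (_×-dec_; _→-dec_; ¬?)

record Graph (n : ℕ) : Set where
  field
    adj    : Fin n → Fin n → Bool
    sym    : ∀ u v → adj u v ≡ adj v u
    irrefl : ∀ u → adj u u ≡ false

-- A 2-edge-coloured graph (Γ, R, B): every edge of Γ gets colour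
-- red (isRed = true) or blue (isRed = false); so R ∩ B = ∅ and R ∪ B = E(Γ).
record TwoEdgeColoured (n : ℕ) : Set where
  field
    Γ      : Graph n
    isRed  : Fin n → Fin n → Bool
    redSym : ∀ u v → isRed u v ≡ isRed v u

module _ {n : ℕ} where
  Edge : Graph n → Fin n → Fin n → Set
  Edge Γ u v = Graph.adj Γ u v ≡ true

  edge? : (Γ : Graph n) → ∀ u v → Dec (Edge Γ u v)
  edge? Γ u v = Graph.adj Γ u v ≟B true

  RedEdge : TwoEdgeColoured n → Fin n → Fin n → Set
  RedEdge G u v = Edge (TwoEdgeColoured.Γ G) u v × TwoEdgeColoured.isRed G u v ≡ true

  BlueEdge : TwoEdgeColoured n → Fin n → Fin n → Set
  BlueEdge G u v = Edge (TwoEdgeColoured.Γ G) u v × TwoEdgeColoured.isRed G u v ≡ false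

  redEdge? : (G : TwoEdgeColoured n) → ∀ u v → Dec (RedEdge G u v)
  redEdge? G u v = edge? (TwoEdgeColoured.Γ G) u v ×-dec (TwoEdgeColoured.isRed G u v ≟B true)

  blueEdge? : (G : TwoEdgeColoured n) → ∀ u v → Dec (BlueEdge G u v)
  blueEdge? G u v = edge? (TwoEdgeColoured.Γ G) u v ×-dec (TwoEdgeColoured.isRed G u v ≟B false)

module _ {n k : ℕ} where
  IsProperColouring : Graph n → Vec (Fin k) n → Set
  IsProperColouring Γ c = ∀ u v → Edge Γ u v → lookup c u ≢ lookup c v

  isProperColouring? : (Γ : Graph n) → (c : Vec (Fin k) n) → Dec (IsProperColouring Γ c)
  isProperColouring? Γ c = all? λ u → all? λ v →
    edge? Γ u v →-dec ¬? (lookup c u ≟F lookup c v)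

  IsColouring : TwoEdgeColoured n → Vec (Fin k) n → Set
  IsColouring G c = IsProperColouring (TwoEdgeColoured.Γ G) c ×
    (∀ u x v y → RedEdge G u x → BlueEdge G v y →
       lookup c u ≡ lookup c v → lookup c x ≢ lookup c y)

  isColouring? : (G : TwoEdgeColoured n) → (c : Vec (Fin k) n) → Dec (IsColouring G c)
  isColouring? G c = isProperColouring? (TwoEdgeColoured.Γ G) c ×-dec
    (all? λ u → all? λ x → all? λ v → all? λ y →
      redEdge? G u x →-dec blueEdge? G v y →-dec
      (lookup c u ≟F lookup c v) →-dec ¬? (lookup c x ≟F lookup c y))

allMaps : (n k : ℕ) → List (Vec (Fin k) n)
allMaps zero    k = [ [] ]
allMaps (suc n) k = concatMap (λ i → map (i ∷_) (allMaps n k)) (allFin k)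

chromaticCount : {n : ℕ} → Graph n → ℕ → ℕ
chromaticCount {n} Γ k = length (filter (isProperColouring? Γ) (allMaps n k))

colouringCount : {n : ℕ} → TwoEdgeColoured n → ℕ → ℕ
colouringCount {n} G k = length (filter (isColouring? G) (allMaps n k))

-- P(G,λ) = P(Γ,λ) as polynomials, i.e. equal values at every k ∈ ℕ
-- (two polynomials agreeing at infinitely many points are equal).
ChromaticallyInvariant : {n : ℕ} → TwoEdgeColoured n → Set
ChromaticallyInvariant G = ∀ k → colouringCount G k ≡ chromaticCount (TwoEdgeColoured.Γ G) k

HasInducedBichromatic2Path : {n : ℕ} → TwoEdgeColoured n → Set
HasInducedBichromatic2Path G =
  ∃[ x ] ∃[ u ] ∃[ y ] (RedEdge G x u × BlueEdge G u y × ¬ Edge (TwoEdgeColoured.Γ G) x y)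

HasInducedBichromatic2K2 : {n : ℕ} → TwoEdgeColoured n → Set
HasInducedBichromatic2K2 G = ∃[ u ] ∃[ x ] ∃[ v ] ∃[ y ]
  ( u ≢ x × u ≢ v × u ≢ y × x ≢ v × x ≢ y × v ≢ y
  × RedEdge G u x × BlueEdge G v y
  × ¬ Edge Γ u v × ¬ Edge Γ u y × ¬ Edge Γ x v × ¬ Edge Γ x y )
  where Γ = TwoEdgeColoured.Γ G

module Submission where

-- A k-colouring of G = (Γ, R, B) is a proper colouring of Γ satisfying an
-- extra condition, so P(G,k) ≤ P(Γ,k), with equality for every k exactly when
-- every proper colouring of Γ is a colouring of G.  The theorem thus reduces
-- to: every proper colouring satisfies the bichromatic condition iff there is
-- no induced bichromatic 2-path and no induced bichromatic 2K₂.
--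
-- For the forward direction, each
-- obstruction is turned into a proper n-colouring violating the condition:
-- start from the injective colouring w ↦ w and recolour the far end(s) of the
-- obstruction with the colour of a non-adjacent vertex.  For the backward
-- direction, a violation (red ux, blue vy, c u = c v, c x = c y) forces uv and
-- xy to be non-edges, and a short case analysis on the edges uy and xv always
-- exhibits an induced bichromatic 2-path or 2K₂.

open import Defs
open import Data.Nat using (ℕ; zero; suc)
open import Data.Product using (_×_; _,_; proj₁; proj₂; Σ-syntax)
open import Data.Sum using (_⊎_; inj₁; inj₂; [_,_]) renaming (map to map-⊎)
open import Data.Bool using (true; false)
open import Data.Fin using (Fin)
open import Data.Fin.Properties using () renaming (_≟_ to _≟F_)
open import Data.Vec using (Vec; []; _∷_; lookup; allFin; _[_]≔_)
open import Data.Vec.Properties using (lookup-allFin; lookup∘update; lookup∘update′)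
open import Data.List using ([]; _∷_; map; length; filter)
open import Data.List.Properties using (filter-≐; filter-complete; filter-reject)
open import Data.List.Membership.Propositional using (_∈_; lose)
open import Data.List.Membership.Propositional.Properties
  using (∈-allFin; ∈-map⁺; ∈-concatMap⁺; ∈-filter⁺; ∈-filter⁻)
open import Data.List.Relation.Unary.Any using (here)
open import Level using (0ℓ)
open import Function using (_∘_)
open import Function.Bundles using (_⇔_; mk⇔)
open import Relation.Nullary using (¬_; yes; no)
open import Relation.Unary using (Pred; Decidable; _⊆_)
open import Relation.Nullary.Decidable using (decidable-stable)
open import Relation.Binary.PropositionalEquality
  using (_≡_; _≢_; refl; sym; trans; cong; subst; module ≡-Reasoning)

module FilterCount {A : Set} {P Q : Pred A 0ℓ}
                   (P? : Decidable P) (Q? : Decidable Q) (P⊆Q : P ⊆ Q) where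

  filter-absorb : ∀ xs → filter P? (filter Q? xs) ≡ filter P? xs
  filter-absorb []       = refl
  filter-absorb (a ∷ as) with Q? a
  ... | no ¬qa = trans (filter-absorb as) (sym (filter-reject P? (¬qa ∘ P⊆Q)))
  ... | yes _  with P? a
  ...   | yes _ = cong (a ∷_) (filter-absorb as)
  ...   | no _  = filter-absorb as

  equal-counts⇒agree : ∀ xs → length (filter P? xs) ≡ length (filter Q? xs) →
                       ∀ {a} → a ∈ xs → Q a → P a
  equal-counts⇒agree xs eq {a} a∈xs qa = proj₂ (∈-filter⁻ P? {xs = filter Q? xs} a∈filterPQ)
    where
    all-kept : filter P? (filter Q? xs) ≡ filter Q? xs
    all-kept = filter-complete P? (trans (cong length (filter-absorb xs)) eq)
    a∈filterPQ : a ∈ filter P? (filter Q? xs)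
    a∈filterPQ = subst (a ∈_) (sym all-kept) (∈-filter⁺ Q? a∈xs qa)

∈-allMaps : ∀ n k (c : Vec (Fin k) n) → c ∈ allMaps n k
∈-allMaps zero    k []      = here refl
∈-allMaps (suc n) k (i ∷ c) =
  ∈-concatMap⁺ (λ j → map (j ∷_) (allMaps n k))
    (lose (∈-allFin i) (∈-map⁺ (i ∷_) (∈-allMaps n k c)))

lookup-recoloured-identity : ∀ {n} {b w : Fin n} i → w ≢ b → lookup (allFin n [ b ]≔ i) w ≡ w
lookup-recoloured-identity {n} {w = w} i w≢b = trans (lookup∘update′ w≢b (allFin n) i) (lookup-allFin w)

module _ {n : ℕ} (Γ : Graph n) where

  edge-sym : ∀ {u v} → Edge Γ u v → Edge Γ v u
  edge-sym {u} {v} e = trans (sym (Graph.sym Γ u v)) e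

  edge-irrefl : ∀ {u} → ¬ Edge Γ u u
  edge-irrefl {u} e with trans (sym e) (Graph.irrefl Γ u)
  ... | ()

  edge⇒distinct : ∀ {u v} → Edge Γ u v → u ≢ v
  edge⇒distinct e refl = edge-irrefl e

  same-colour⇒non-adjacent : ∀ {k} (c : Vec (Fin k) n) → IsProperColouring Γ c →
                             ∀ {u v} → lookup c u ≡ lookup c v → ¬ Edge Γ u v
  same-colour⇒non-adjacent c pc eq e = pc _ _ e eq

  identity-proper : IsProperColouring Γ (allFin n)
  identity-proper u v e eq =
    edge⇒distinct e (trans (sym (lookup-allFin u)) (trans eq (lookup-allFin v)))

  recolour-proper : ∀ {k} (c : Vec (Fin k) n) b i → IsProperColouring Γ c →
                    (∀ z → Edge Γ b z → lookup c z ≢ i) →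
                    IsProperColouring Γ (c [ b ]≔ i)
  recolour-proper c b i pc fresh w z e eq with w ≟F b | z ≟F b
  ... | yes refl | yes refl = edge-irrefl e
  ... | yes refl | no z≢b   =
    fresh z e (sym (trans (sym (lookup∘update w c i)) (trans eq (lookup∘update′ z≢b c i))))
  ... | no w≢b   | yes refl =
    fresh w (edge-sym e) (trans (sym (lookup∘update′ w≢b c i)) (trans eq (lookup∘update z c i)))
  ... | no w≢b   | no z≢b   =
    pc w z e (trans (sym (lookup∘update′ w≢b c i)) (trans eq (lookup∘update′ z≢b c i)))

  identify-proper : ∀ {x y} → ¬ Edge Γ x y → IsProperColouring Γ (allFin n [ y ]≔ x)
  identify-proper {x} {y} ¬xy = recolour-proper (allFin n) y x identity-proper
    (λ z eyz z≡x → ¬xy (edge-sym (subst (Edge Γ y) (trans (sym (lookup-allFin z)) z≡x) eyz)))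

module _ {n : ℕ} (G : TwoEdgeColoured n) where
  open TwoEdgeColoured G using (Γ; isRed; redSym)

  E : Fin n → Fin n → Set
  E = Edge Γ

  red-sym : ∀ {u v} → RedEdge G u v → RedEdge G v u
  red-sym {u} {v} (e , r) = edge-sym Γ e , trans (sym (redSym u v)) r

  blue-sym : ∀ {u v} → BlueEdge G u v → BlueEdge G v u
  blue-sym {u} {v} (e , r) = edge-sym Γ e , trans (sym (redSym u v)) r

  red⇒not-blue : ∀ {u v} → RedEdge G u v → ¬ BlueEdge G u v
  red⇒not-blue (_ , r) (_ , b) with trans (sym r) b
  ... | ()

  edge-colour : ∀ {u v} → E u v → RedEdge G u v ⊎ BlueEdge G u v
  edge-colour {u} {v} e = map-⊎ (e ,_) (e ,_) (true-or-false (isRed u v))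
    where
    true-or-false : ∀ b → b ≡ true ⊎ b ≡ false
    true-or-false true  = inj₁ refl
    true-or-false false = inj₂ refl

  BadColouring : ∀ {k} → Vec (Fin k) n → Set
  BadColouring c = IsProperColouring Γ c × ¬ IsColouring G c

  invariant⇒no-bad-colouring : ChromaticallyInvariant G → ¬ (Σ[ c ∈ Vec (Fin n) n ] BadColouring c)
  invariant⇒no-bad-colouring inv (c , pc , ¬col) =
    ¬col (equal-counts⇒agree (allMaps n n) (inv n) (∈-allMaps n n c) pc)
    where open FilterCount (isColouring? G) (isProperColouring? Γ) proj₁

  no-bad-colouring⇒invariant : (∀ {k} (c : Vec (Fin k) n) → ¬ BadColouring c) → ChromaticallyInvariant G
  no-bad-colouring⇒invariant noBad k =
    cong length (filter-≐ (isColouring? G) (isProperColouring? Γ) (proj₁ , λ {c} → col {c}) (allMaps n k))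
    where
    col : IsProperColouring Γ ⊆ IsColouring G
    col {c} pc = decidable-stable (isColouring? G c) (λ ¬col → noBad c (pc , ¬col))

  -- Induced bichromatic 2-path x u y: recolour y with the colour x.  Then u,u
  -- share a colour along red ux and blue uy, and so do x,y.
  2-path⇒bad-colouring : HasInducedBichromatic2Path G → Σ[ c ∈ Vec (Fin n) n ] BadColouring c
  2-path⇒bad-colouring (x , u , y , rxu , buy , ¬xy) = c , proper , violated
    where
    c : Vec (Fin n) n
    c = allFin n [ y ]≔ x
    x≢y : x ≢ y
    x≢y refl = red⇒not-blue (red-sym rxu) buy
    proper : IsProperColouring Γ c
    proper = identify-proper Γ ¬xy
    violated : ¬ IsColouring G c
    violated (_ , cond) = cond u x u y (red-sym rxu) buy refl
      (trans (lookup-recoloured-identity x x≢y) (sym (lookup∘update y (allFin n) x)))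

  2K2⇒bad-colouring : HasInducedBichromatic2K2 G → Σ[ c ∈ Vec (Fin n) n ] BadColouring c
  2K2⇒bad-colouring (u , x , v , y , u≢x , u≢v , u≢y , x≢v , x≢y , v≢y ,
                     rux , bvy , ¬uv , ¬uy , ¬xv , ¬xy) = c , proper , violated
    where
    c₁ c : Vec (Fin n) n
    c₁ = allFin n [ y ]≔ x
    c  = c₁ [ v ]≔ u
    proper₁ : IsProperColouring Γ c₁
    proper₁ = identify-proper Γ ¬xy
    -- No neighbour of v has colour u in c₁ (only y was recoloured, to x ≠ u).
    fresh-u : ∀ z → E v z → lookup c₁ z ≢ u
    fresh-u z evz z≡u with z ≟F y
    ... | yes refl = u≢x (trans (sym z≡u) (lookup∘update y (allFin n) x))
    ... | no z≢y   = ¬uv (edge-sym Γ (subst (E v) (trans (sym (lookup-recoloured-identity x z≢y)) z≡u) evz))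
    proper : IsProperColouring Γ c
    proper = recolour-proper Γ c₁ v u proper₁ fresh-u
    violated : ¬ IsColouring G c
    violated (_ , cond) = cond u x v y rux bvy
      (begin
        lookup c u  ≡⟨ lookup∘update′ u≢v c₁ u ⟩
        lookup c₁ u ≡⟨ lookup-recoloured-identity x u≢y ⟩
        u           ≡⟨ lookup∘update v c₁ u ⟨
        lookup c v  ∎)
      (begin
        lookup c x  ≡⟨ lookup∘update′ x≢v c₁ u ⟩
        lookup c₁ x ≡⟨ lookup-recoloured-identity x x≢y ⟩
        x           ≡⟨ lookup∘update y (allFin n) x ⟨
        lookup c₁ y ≡⟨ lookup∘update′ (v≢y ∘ sym) c₁ u ⟨
        lookup c y  ∎)
      where open ≡-Reasoning

  -- Red ux, blue vy with uv, xy non-edges: an edge uy closes an induced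
  -- bichromatic 2-path (u y v if uy is red, x u y if it is blue).
  cross-edge⇒2-path : ∀ {u x v y} → RedEdge G u x → BlueEdge G v y → ¬ E u v → ¬ E x y →
                      E u y → HasInducedBichromatic2Path G
  cross-edge⇒2-path {u} {x} {v} {y} rux bvy ¬uv ¬xy euy with edge-colour euy
  ... | inj₁ ruy = u , y , v , ruy , blue-sym bvy , ¬uv
  ... | inj₂ buy = x , u , y , red-sym rux , buy , ¬xy

  obstruction : ∀ {u x v y} → RedEdge G u x → BlueEdge G v y → ¬ E u v → ¬ E x y →
                HasInducedBichromatic2Path G ⊎ HasInducedBichromatic2K2 G
  obstruction {u} {x} {v} {y} rux bvy ¬uv ¬xy with u ≟F v | x ≟F y
  ... | yes refl | _        = inj₁ (x , u , y , red-sym rux , bvy , ¬xy)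
  ... | no _     | yes refl = inj₁ (u , x , v , rux , blue-sym bvy , ¬uv)
  ... | no u≢v   | no x≢y   with edge? Γ u y | edge? Γ x v
  ...   | yes euy | _       = inj₁ (cross-edge⇒2-path rux bvy ¬uv ¬xy euy)
  ...   | no _    | yes exv = inj₁ (cross-edge⇒2-path (red-sym rux) (blue-sym bvy) ¬xy ¬uv exv)
  ...   | no ¬uy  | no ¬xv  = inj₂ (u , x , v , y , edge⇒distinct Γ (proj₁ rux) , u≢v , u≢y , x≢v ,
                                    x≢y , edge⇒distinct Γ (proj₁ bvy) , rux , bvy , ¬uv , ¬uy , ¬xv , ¬xy)
    where
    u≢y : u ≢ y
    u≢y refl = ¬uv (edge-sym Γ (proj₁ bvy))
    x≢v : x ≢ v
    x≢v refl = ¬uv (proj₁ rux)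

  obstruction-free⇒no-bad-colouring : ¬ HasInducedBichromatic2Path G → ¬ HasInducedBichromatic2K2 G →
                                      ∀ {k} (c : Vec (Fin k) n) → ¬ BadColouring c
  obstruction-free⇒no-bad-colouring ¬path ¬2K2 c (pc , ¬col) = ¬col (pc , condition)
    where
    condition : ∀ u x v y → RedEdge G u x → BlueEdge G v y →
                lookup c u ≡ lookup c v → lookup c x ≢ lookup c y
    condition u x v y rux bvy cu≡cv cx≡cy =
      [ ¬path , ¬2K2 ] (obstruction rux bvy (same-colour⇒non-adjacent Γ c pc cu≡cv)
                                            (same-colour⇒non-adjacent Γ c pc cx≡cy))

theorem7 : {n : ℕ} (G : TwoEdgeColoured n) →
    ChromaticallyInvariant G ⇔ (¬ HasInducedBichromatic2Path G × ¬ HasInducedBichromatic2K2 G)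
theorem7 G = mk⇔ forward backward
  where
  forward : ChromaticallyInvariant G → ¬ HasInducedBichromatic2Path G × ¬ HasInducedBichromatic2K2 G
  forward inv = invariant⇒no-bad-colouring G inv ∘ 2-path⇒bad-colouring G
              , invariant⇒no-bad-colouring G inv ∘ 2K2⇒bad-colouring G
  backward : ¬ HasInducedBichromatic2Path G × ¬ HasInducedBichromatic2K2 G → ChromaticallyInvariant G
  backward (¬path , ¬2K2) = no-bad-colouring⇒invariant G (obstruction-free⇒no-bad-colouring G ¬path ¬2K2)
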